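{- There exists $n_0\in\mathbb N$ such that for all $n\ge n_0$ the complete bipartite digraph $D_{n,n}$ contains $n$ edge-disjoint Hamilton paths, all starting in the same vertex class of the bipartition. Moreover, every vertex of $D_{n,n}$ is an endpoint of at most $2\sqrt{\log n}$ of these paths.
   Context: $D_{n,n}$ is the digraph with vertex classes $A,B$ of size $n$ each, whose edge set consists of all ordered pairs $(a,b)$ and $(b,a)$ with $a\in A$, $b\in B$; every vertex has in- and out-degree $n$. A Hamilton path is a directed path containing every vertex of the digraph. -}

module Defs where

open import Data.Bool using (Bool)
open import Data.Nat using (ℕ; zero; suc; _+_; _*_; _∸_; _^_; _≤_; _!)

open import Data.Fin using (Fin; toℕ)
open import Data.Product using (_×_; proj₁; ∃; ∃-syntax)
open import Data.Sum using (_⊎_)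
open import Data.List using (List; length)
open import Data.List.Relation.Unary.All using (All)
open import Data.List.Relation.Unary.Unique.Propositional using (Unique)
open import Relation.Binary.PropositionalEquality using (_≡_; _≢_)
open import Relation.Nullary using (¬_)

-- The complete bipartite digraph D_{n,n}.
-- Vertices: Bool × Fin n; the class is the Bool (A = false, B = true).
-- Arcs: all ordered pairs (u , v) with u and v in different classes.

Vtx : ℕ → Set
Vtx n = Bool × Fin n

Class : ∀ {n} → Vtx n → Bool
Class = proj₁

Arc : ∀ {n} → Vtx n → Vtx n → Set
Arc u v = Class u ≢ Class v

Seq : ℕ → Set
Seq n = Fin (n + n) → Vtx n

Uses : ∀ {n} → Seq n → Vtx n → Vtx n → Set
Uses {n} P u v = ∃[ i ] ∃[ j ] (suc (toℕ i) ≡ toℕ j × P i ≡ u × P j ≡ v)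

-- A Hamilton path of D_{n,n}: every vertex occurs exactly once (the map
-- Fin (n+n) → Vtx n is injective, hence bijective), and consecutive
-- vertices are joined by an arc of D_{n,n}.
IsHamPath : ∀ {n} → Seq n → Set
IsHamPath {n} P =
  (∀ i j → P i ≡ P j → i ≡ j) ×
  (∀ u v → Uses P u v → Arc u v)

IsStart : ∀ {n} → Seq n → Vtx n → Set
IsStart P v = ∃[ i ] (toℕ i ≡ 0 × P i ≡ v)

IsEnd : ∀ {n} → Seq n → Vtx n → Set
IsEnd {n} P v = ∃[ i ] (toℕ i ≡ (n + n) ∸ 1 × P i ≡ v)

IsEndpoint : ∀ {n} → Seq n → Vtx n → Set
IsEndpoint P v = IsStart P v ⊎ IsEnd P v

EdgeDisjoint : ∀ {n m} → (Fin m → Seq n) → Set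
EdgeDisjoint {n} {m} P =
  ∀ k l → k ≢ l → ∀ u v → ¬ (Uses (P k) u v × Uses (P l) u v)

AtMostEndpoints : ∀ {n m} → (Fin m → Seq n) → Vtx n → ℕ → Set
AtMostEndpoints {n} {m} P v b =
  ∀ (S : List (Fin m)) → Unique S → All (λ k → IsEndpoint (P k) v) S →
  length S ≤ b

-- Real-number bound without reals.
-- expPartial x K = K! * Σ_{j=0}^{K} x^j / j!  (a natural number), via
--   expPartial x 0 = 1,  expPartial x (K+1) = (K+1)·expPartial x K + x^(K+1).
expPartial : ℕ → ℕ → ℕ
expPartial x zero    = 1
expPartial x (suc K) = suc K * expPartial x K + x ^ suc K

-- ExpLe x N  :⇔  e^x ≤ N   (the partial sums of the exponential series
-- increase to e^x, so e^x ≤ N iff every partial sum is ≤ N).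
ExpLe : ℕ → ℕ → Set
ExpLe x N = ∀ K → expPartial x K ≤ N * (K !)

-- b ≤ 2 √(ln n)  ⇔  b² ≤ 4 ln n  ⇔  e^(b²) ≤ n⁴   (b a natural number)
LeTwoSqrtLog : ℕ → ℕ → Set
LeTwoSqrtLog b n = ExpLe (b * b) (n ^ 4)

{-# OPTIONS --safe #-}
-- Write A = {a₀,…,aₙ₋₁} and B = {b₀,…,bₙ₋₁}, indices mod n. For 0 ≤ k < n the
-- k-th path is a_k b_{2k+1} a_{k+1} b_{2k+2} … a_{k+n-1} b_{2k+n}. Each of its
-- arcs a_i → b_j has j - i ≡ k + 1 and each of its arcs b_j → a_i has
-- j - i ≡ k, so an arc determines the path using it. Path k runs from a_k to
-- b_{2k}, hence a vertex of A is an endpoint of one path and a vertex of B of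
-- at most two, as k ↦ 2k is at most two-to-one mod n. Finally
-- 2 ≤ 2√(log n) means e ≤ n, which holds for n ≥ 3.
module Submission where

open import Defs
open import Data.Nat using (ℕ; _≥_; zero; suc; _+_; _*_; _∸_; _^_; _≤_; _<_; z≤n; s≤s; NonZero; _!; ⌊_/2⌋; ⌈_/2⌉; ∣_-_∣; _<?_)
open import Data.Nat.Properties
open import Data.Nat.DivMod using (_%_; _/_; _mod_; m≡m%n+[m/n]*n; m<n⇒m%n≡m; %-distribˡ-+; [m+n]%n≡m%n; m≤n⇒[n∸m]%m≡n%m)
open import Data.Nat.Divisibility using (_∣_; divides; n∣m⇒m%n≡0)
open import Algebra.Properties.CommutativeSemigroup +-commutativeSemigroup
  using () renaming (xy∙z≈xz∙y to [m+n]+o≡[m+o]+n)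
open import Algebra.Properties.CommutativeSemigroup *-commutativeSemigroup
  using () renaming (x∙yz≈y∙xz to m*[n*o]≡n*[m*o])
open import Data.Bool using (Bool; true; false; not)
open import Data.Bool.Properties using (not-¬)
open import Data.Fin using (Fin; toℕ)
open import Data.Fin.Properties using (toℕ-fromℕ<; toℕ-injective; toℕ<n)
open import Data.Product using (Σ; _×_; ∃-syntax; _,_; proj₁; proj₂)
open import Data.Sum using (_⊎_; inj₁; inj₂; swap)
open import Data.Empty using (⊥-elim)
open import Function using (_∘_)
open import Data.List using (length)
open import Data.List.Relation.Unary.All as All using (All; []; _∷_)
open import Data.List.Relation.Unary.AllPairs using ([]; _∷_)
open import Data.List.Relation.Unary.Unique.Propositional using (Unique)
open import Relation.Binary.PropositionalEquality
open import Relation.Nullary using (yes; no)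
open import Relation.Unary using (Pred; _∪_)
open import Level using (0ℓ)

infix 4 _≡_[mod_]

record _≡_[mod_] (x y n : ℕ) .{{_ : NonZero n}} : Set where
  constructor mod-≡
  field %-≡ : x % n ≡ y % n

open _≡_[mod_]

module _ {n : ℕ} .{{_ : NonZero n}} where

  mod≡⇒≡[mod] : ∀ {x y} → x mod n ≡ y mod n → x ≡ y [mod n ]
  mod≡⇒≡[mod] {x} {y} e = mod-≡ (begin
    x % n           ≡⟨ toℕ-fromℕ< _ ⟨
    toℕ (x mod n)   ≡⟨ cong toℕ e ⟩
    toℕ (y mod n)   ≡⟨ toℕ-fromℕ< _ ⟩
    y % n           ∎)
    where open ≡-Reasoning

  +-cong-≡[mod] : ∀ {x y z w} → x ≡ y [mod n ] → z ≡ w [mod n ] → x + z ≡ y + w [mod n ]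
  +-cong-≡[mod] {x} {y} {z} {w} (mod-≡ x≡y) (mod-≡ z≡w) = mod-≡ (begin
    (x + z) % n           ≡⟨ %-distribˡ-+ x z n ⟩
    (x % n + z % n) % n   ≡⟨ cong₂ (λ a b → (a + b) % n) x≡y z≡w ⟩
    (y % n + w % n) % n   ≡⟨ %-distribˡ-+ y w n ⟨
    (y + w) % n           ∎)
    where open ≡-Reasoning

  ≡[mod]⇒∣∣-∣ : ∀ {x y} → x ≡ y [mod n ] → n ∣ ∣ x - y ∣
  ≡[mod]⇒∣∣-∣ {x} {y} (mod-≡ x≡y) = divides ∣ x / n - y / n ∣ (begin
    ∣ x - y ∣                                   ≡⟨ cong₂ ∣_-_∣ (m≡m%n+[m/n]*n x n) (m≡m%n+[m/n]*n y n) ⟩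
    ∣ x % n + x / n * n - y % n + y / n * n ∣   ≡⟨ cong (λ r → ∣ x % n + x / n * n - r + y / n * n ∣) x≡y ⟨
    ∣ x % n + x / n * n - x % n + y / n * n ∣   ≡⟨ ∣m+n-m+o∣≡∣n-o∣ (x % n) _ _ ⟩
    ∣ x / n * n - y / n * n ∣                   ≡⟨ *-distribʳ-∣-∣ n (x / n) (y / n) ⟨
    ∣ x / n - y / n ∣ * n                       ∎)
    where open ≡-Reasoning

  +-cancel-≡[mod] : ∀ {x y k l} → x ≡ y [mod n ] → x + k ≡ y + l [mod n ] → k < n → l < n → k ≡ l
  +-cancel-≡[mod] {x} {y} {k} {l} x≡y x+k≡y+l k<n l<n = ∣m-n∣≡0⇒m≡n (begin
    ∣ k - l ∣       ≡⟨ m<n⇒m%n≡m ∣k-l∣<n ⟨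
    ∣ k - l ∣ % n   ≡⟨ n∣m⇒m%n≡0 _ n n∣∣k-l∣ ⟩
    0               ∎)
    where
    open ≡-Reasoning
    ∣k-l∣<n : ∣ k - l ∣ < n
    ∣k-l∣<n = ≤-<-trans (∣m-n∣≤m⊔n k l) (⊔-pres-<m k<n l<n)
    y+k≡y+l : y + k ≡ y + l [mod n ]
    y+k≡y+l = mod-≡ (trans (sym (%-≡ (+-cong-≡[mod] x≡y (mod-≡ refl)))) (%-≡ x+k≡y+l))
    n∣∣k-l∣ : n ∣ ∣ k - l ∣
    n∣∣k-l∣ = subst (n ∣_) (∣m+n-m+o∣≡∣n-o∣ y k l) (≡[mod]⇒∣∣-∣ y+k≡y+l)

  m<n+n⇒m≡m%n⊎m≡m%n+n : ∀ {x} → x < n + n → x ≡ x % n ⊎ x ≡ x % n + n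
  m<n+n⇒m≡m%n⊎m≡m%n+n {x} x<n+n with x <? n
  ... | yes x<n = inj₁ (sym (m<n⇒m%n≡m x<n))
  ... | no x≮n = inj₂ (begin
    x               ≡⟨ m∸n+n≡m n≤x ⟨
    x ∸ n + n       ≡⟨ cong (_+ n) (m<n⇒m%n≡m (m<n+o⇒m∸n<o x n x<n+n)) ⟨
    (x ∸ n) % n + n ≡⟨ cong (_+ n) (m≤n⇒[n∸m]%m≡n%m n≤x) ⟩
    x % n + n       ∎)
    where
    open ≡-Reasoning
    n≤x : n ≤ x
    n≤x = ≮⇒≥ x≮n

isOdd : ℕ → Bool
isOdd zero          = false
isOdd (suc zero)    = true
isOdd (suc (suc q)) = isOdd q

isOdd-suc : ∀ q → isOdd (suc q) ≡ not (isOdd q)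
isOdd-suc zero          = refl
isOdd-suc (suc zero)    = refl
isOdd-suc (suc (suc q)) = isOdd-suc q

isOdd-1+m+m : ∀ m → isOdd (suc (m + m)) ≡ true
isOdd-1+m+m zero    = refl
isOdd-1+m+m (suc m) rewrite +-suc m m = isOdd-1+m+m m

even⇒⌊1+n/2⌋≡⌊n/2⌋ : ∀ {q} → isOdd q ≡ false → ⌊ suc q /2⌋ ≡ ⌊ q /2⌋
even⇒⌊1+n/2⌋≡⌊n/2⌋ {zero}        _    = refl
even⇒⌊1+n/2⌋≡⌊n/2⌋ {suc (suc q)} even = cong suc (even⇒⌊1+n/2⌋≡⌊n/2⌋ even)

odd⇒⌊1+n/2⌋≡1+⌊n/2⌋ : ∀ {q} → isOdd q ≡ true → ⌊ suc q /2⌋ ≡ suc ⌊ q /2⌋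
odd⇒⌊1+n/2⌋≡1+⌊n/2⌋ {suc zero}    _   = refl
odd⇒⌊1+n/2⌋≡1+⌊n/2⌋ {suc (suc q)} odd = cong suc (odd⇒⌊1+n/2⌋≡1+⌊n/2⌋ odd)

isOdd-⌊n/2⌋-injective : ∀ {p q} → isOdd p ≡ isOdd q → ⌊ p /2⌋ ≡ ⌊ q /2⌋ → p ≡ q
isOdd-⌊n/2⌋-injective {zero}        {zero}        _ _ = refl
isOdd-⌊n/2⌋-injective {suc zero}    {suc zero}    _ _ = refl
isOdd-⌊n/2⌋-injective {suc (suc p)} {suc (suc q)} same-parity same-half =
  cong (2 +_) (isOdd-⌊n/2⌋-injective same-parity (suc-injective same-half))
isOdd-⌊n/2⌋-injective {zero}        {suc zero}    () _
isOdd-⌊n/2⌋-injective {suc zero}    {zero}        () _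
isOdd-⌊n/2⌋-injective {zero}        {suc (suc q)} _ ()
isOdd-⌊n/2⌋-injective {suc zero}    {suc (suc q)} _ ()
isOdd-⌊n/2⌋-injective {suc (suc p)} {zero}        _ ()
isOdd-⌊n/2⌋-injective {suc (suc p)} {suc zero}    _ ()

m+m≡n+n⇒m≡n : ∀ {m n} → m + m ≡ n + n → m ≡ n
m+m≡n+n⇒m≡n {m} {n} e = trans (n≡⌊n+n/2⌋ m) (trans (cong ⌊_/2⌋ e) (sym (n≡⌊n+n/2⌋ n)))

m<n+n⇒⌊m/2⌋<n : ∀ {m n} → m < n + n → ⌊ m /2⌋ < n
m<n+n⇒⌊m/2⌋<n {n = n} m<n+n = subst (_ ≤_) (sym (n≡⌈n+n/2⌉ n)) (⌈n/2⌉-mono m<n+n)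

AtMostOne : ∀ {A : Set} → Pred A 0ℓ → Set
AtMostOne Q = ∀ {x y} → Q x → Q y → x ≡ y

module _ {A : Set} where

  unique-all-length≤1 : ∀ {Q : Pred A 0ℓ} {xs} → AtMostOne Q → Unique xs → All Q xs → length xs ≤ 1
  unique-all-length≤1 _  []                   []             = z≤n
  unique-all-length≤1 _  ([] ∷ [])            (_ ∷ [])       = s≤s z≤n
  unique-all-length≤1 Q! ((x≢y ∷ _) ∷ _ ∷ _)  (qx ∷ qy ∷ _)  = ⊥-elim (x≢y (Q! qx qy))

  all-∪-distinct⇒all : ∀ {Q R : Pred A 0ℓ} {x xs} → AtMostOne Q → Q x →
                       All (x ≢_) xs → All (Q ∪ R) xs → All R xs
  all-∪-distinct⇒all {Q} {R} {x} Q! qx x∉xs qrs = All.zipWith pick (x∉xs , qrs)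
    where
    pick : ∀ {y} → x ≢ y × (Q ∪ R) y → R y
    pick (x≢y , inj₁ qy) = ⊥-elim (x≢y (Q! qx qy))
    pick (_   , inj₂ ry) = ry

  unique-all-length≤2 : ∀ {Q R : Pred A 0ℓ} {xs} → AtMostOne Q → AtMostOne R →
                        Unique xs → All (Q ∪ R) xs → length xs ≤ 2
  unique-all-length≤2 _  _  []            []             = z≤n
  unique-all-length≤2 Q! R! (x∉xs ∷ uxs)  (inj₁ qx ∷ qrs) =
    s≤s (unique-all-length≤1 R! uxs (all-∪-distinct⇒all Q! qx x∉xs qrs))
  unique-all-length≤2 Q! R! (x∉xs ∷ uxs)  (inj₂ rx ∷ qrs) =
    s≤s (unique-all-length≤1 Q! uxs (all-∪-distinct⇒all R! rx x∉xs (All.map swap qrs)))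

-- Once x ≤ K the tail Σ_{j>K} x^j/j! is at most x^(K+1)/K!, so ExpTailLe x N K
-- certifies e^x ≤ N.
ExpTailLe : ℕ → ℕ → ℕ → Set
ExpTailLe x N K = expPartial x K + x ^ suc K ≤ N * K !

expTailLe-suc : ∀ {x N K} → x ≤ K → ExpTailLe x N K → ExpTailLe x N (suc K)
expTailLe-suc {x} {N} {K} x≤K tail≤ = begin
  suc K * E + X + x * X      ≡⟨ +-assoc (suc K * E) X (x * X) ⟩
  suc K * E + suc x * X      ≤⟨ +-monoʳ-≤ (suc K * E) (*-monoˡ-≤ X (s≤s x≤K)) ⟩
  suc K * E + suc K * X      ≡⟨ *-distribˡ-+ (suc K) E X ⟨
  suc K * (E + X)            ≤⟨ *-monoʳ-≤ (suc K) tail≤ ⟩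
  suc K * (N * K !)          ≡⟨ m*[n*o]≡n*[m*o] (suc K) N (K !) ⟩
  N * suc K !                ∎
  where
  open ≤-Reasoning
  E X : ℕ
  E = expPartial x K
  X = x ^ suc K

expPartial-≤-pred : ∀ {x N K} → expPartial x (suc K) ≤ N * suc K ! → expPartial x K ≤ N * K !
expPartial-≤-pred {x} {N} {K} bound = *-cancelˡ-≤ (suc K) (begin
  suc K * expPartial x K                ≤⟨ m≤m+n _ _ ⟩
  expPartial x (suc K)                  ≤⟨ bound ⟩
  N * suc K !                           ≡⟨ m*[n*o]≡n*[m*o] N (suc K) (K !) ⟩
  suc K * (N * K !)                     ∎)
  where open ≤-Reasoning

expTailLe⇒expLe : ∀ {x N} K → x ≤ K → ExpTailLe x N K → ExpLe x N
expTailLe⇒expLe {x} {N} K x≤K tail≤ K′ =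
  downward K (subst Bounded (+-comm K′ K) (≤-trans (m≤m+n _ (x ^ suc (K′ + K))) (upward K′)))
  where
  Bounded : ℕ → Set
  Bounded K = expPartial x K ≤ N * K !
  upward : ∀ d → ExpTailLe x N (d + K)
  upward zero    = tail≤
  upward (suc d) = expTailLe-suc {N = N} (≤-trans x≤K (m≤n+m K d)) (upward d)
  downward : ∀ d {k} → Bounded (d + k) → Bounded k
  downward zero        bound = bound
  downward (suc d) {k} bound = downward d (expPartial-≤-pred {x} {N} {d + k} bound)

expLe-monoʳ : ∀ {x N M} → N ≤ M → ExpLe x N → ExpLe x M
expLe-monoʳ N≤M e^x≤N K = ≤-trans (e^x≤N K) (*-monoˡ-≤ (K !) N≤M)

-- expPartial 4 4 + 4 ^ 5 = 1848 ≤ 1944 = 81 * 4 !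
e⁴≤81 : ExpLe 4 81
e⁴≤81 = expTailLe⇒expLe {N = 81} 4 ≤-refl (m≤m+n 1848 96)

2≤2√log : ∀ {n} → 3 ≤ n → LeTwoSqrtLog 2 n
2≤2√log 3≤n = expLe-monoʳ (^-monoˡ-≤ 4 3≤n) e⁴≤81

module RotationPaths (m : ℕ) where

  private
    n : ℕ
    n = suc m

  offset : ℕ → Bool → ℕ
  offset k false = k
  offset k true  = suc (k + k)

  label : ℕ → ℕ → ℕ
  label k q = offset k (isOdd q) + ⌊ q /2⌋

  vertex : ℕ → ℕ → Vtx n
  vertex k q = isOdd q , label k q mod n

  path : Fin n → Seq n
  path k i = vertex (toℕ k) (toℕ i)

  even⇒label[1+q]≡1+label[q]+k : ∀ k {q} → isOdd q ≡ false → label k (suc q) ≡ suc (label k q) + k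
  even⇒label[1+q]≡1+label[q]+k k {q} even = begin
    offset k (isOdd (suc q)) + ⌊ suc q /2⌋   ≡⟨ cong₂ (λ b h → offset k b + h) (trans (isOdd-suc q) (cong not even)) (even⇒⌊1+n/2⌋≡⌊n/2⌋ even) ⟩
    suc (k + k + ⌊ q /2⌋)                     ≡⟨ cong suc ([m+n]+o≡[m+o]+n k k ⌊ q /2⌋) ⟩
    suc (k + ⌊ q /2⌋) + k                     ≡⟨ cong (λ b → suc (offset k b + ⌊ q /2⌋) + k) even ⟨
    suc (label k q) + k                       ∎
    where open ≡-Reasoning

  odd⇒label[q]≡label[1+q]+k : ∀ k {q} → isOdd q ≡ true → label k q ≡ label k (suc q) + k
  odd⇒label[q]≡label[1+q]+k k {q} odd = begin
    offset k (isOdd q) + ⌊ q /2⌋               ≡⟨ cong (λ b → offset k b + ⌊ q /2⌋) odd ⟩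
    suc (k + k + ⌊ q /2⌋)                      ≡⟨ cong suc ([m+n]+o≡[m+o]+n k k ⌊ q /2⌋) ⟩
    suc (k + ⌊ q /2⌋) + k                      ≡⟨ cong (_+ k) (+-suc k ⌊ q /2⌋) ⟨
    k + suc ⌊ q /2⌋ + k                        ≡⟨ cong₂ (λ b h → offset k b + h + k) (trans (isOdd-suc q) (cong not odd)) (odd⇒⌊1+n/2⌋≡1+⌊n/2⌋ odd) ⟨
    offset k (isOdd (suc q)) + ⌊ suc q /2⌋ + k ∎
    where open ≡-Reasoning

  label-end : ∀ k → label k (n + n ∸ 1) ≡ k + k + n
  label-end k = begin
    label k (m + suc m)                          ≡⟨ cong (label k) (+-suc m m) ⟩
    offset k (isOdd (suc (m + m))) + ⌈ m + m /2⌉ ≡⟨ cong₂ (λ b h → offset k b + h) (isOdd-1+m+m m) (sym (n≡⌈n+n/2⌉ m)) ⟩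
    suc (k + k) + m                              ≡⟨ +-suc (k + k) m ⟨
    k + k + n                                    ∎
    where open ≡-Reasoning

  isOdd-end : isOdd (n + n ∸ 1) ≡ true
  isOdd-end = trans (cong isOdd (+-suc m m)) (isOdd-1+m+m m)

  vertex-injective : ∀ {k p q} → p < n + n → q < n + n → vertex k p ≡ vertex k q → p ≡ q
  vertex-injective {k} {p} {q} p<2n q<2n e = isOdd-⌊n/2⌋-injective same-parity
    (+-cancel-≡[mod] same-offset same-label (m<n+n⇒⌊m/2⌋<n p<2n) (m<n+n⇒⌊m/2⌋<n q<2n))
    where
    same-parity : isOdd p ≡ isOdd q
    same-parity = cong proj₁ e
    same-offset : offset k (isOdd p) ≡ offset k (isOdd q) [mod n ]
    same-offset = mod-≡ (cong (λ b → offset k b % n) same-parity)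
    same-label : label k p ≡ label k q [mod n ]
    same-label = mod≡⇒≡[mod] (cong proj₂ e)

  Consecutive : ℕ → Vtx n → Vtx n → Set
  Consecutive k u v = ∃[ q ] (vertex k q ≡ u × vertex k (suc q) ≡ v)

  arc-determines-path : ∀ {k l u v} → k < n → l < n → Consecutive k u v → Consecutive l u v → k ≡ l
  arc-determines-path {k} {l} k<n l<n (p , refl , refl) (q , tails , heads) = by-parity (isOdd p) refl
    where
    same-parity : isOdd p ≡ isOdd q
    same-parity = cong proj₁ (sym tails)
    tails≡ : label k p ≡ label l q [mod n ]
    tails≡ = mod≡⇒≡[mod] (cong proj₂ (sym tails))
    heads≡ : label k (suc p) ≡ label l (suc q) [mod n ]
    heads≡ = mod≡⇒≡[mod] (cong proj₂ (sym heads))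
    by-parity : ∀ b → isOdd p ≡ b → k ≡ l
    by-parity false even = +-cancel-≡[mod] (+-cong-≡[mod] {x = 1} (mod-≡ refl) tails≡) heads≡′ k<n l<n
      where
      heads≡′ : suc (label k p) + k ≡ suc (label l q) + l [mod n ]
      heads≡′ = subst₂ (λ a b → a ≡ b [mod n ])
        (even⇒label[1+q]≡1+label[q]+k k {p} even)
        (even⇒label[1+q]≡1+label[q]+k l {q} (trans (sym same-parity) even)) heads≡
    by-parity true odd = +-cancel-≡[mod] heads≡ tails≡′ k<n l<n
      where
      tails≡′ : label k (suc p) + k ≡ label l (suc q) + l [mod n ]
      tails≡′ = subst₂ (λ a b → a ≡ b [mod n ])
        (odd⇒label[q]≡label[1+q]+k k {p} odd)
        (odd⇒label[q]≡label[1+q]+k l {q} (trans (sym same-parity) odd)) tails≡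

  uses⇒consecutive : ∀ {k u v} → Uses (path k) u v → Consecutive (toℕ k) u v
  uses⇒consecutive {k} (i , j , i+1≡j , refl , refl) = toℕ i , refl , cong (vertex (toℕ k)) i+1≡j

  consecutive⇒arc : ∀ {k u v} → Consecutive k u v → Arc u v
  consecutive⇒arc (q , refl , refl) same-class = not-¬ refl (trans same-class (isOdd-suc q))

  path-isHamPath : ∀ k → IsHamPath (path k)
  path-isHamPath k = (λ i j e → toℕ-injective (vertex-injective (toℕ<n i) (toℕ<n j) e))
                   , λ u v uses → consecutive⇒arc (uses⇒consecutive uses)

  paths-edgeDisjoint : EdgeDisjoint path
  paths-edgeDisjoint k l k≢l u v (k-uses , l-uses) = k≢l (toℕ-injective
    (arc-determines-path (toℕ<n k) (toℕ<n l) (uses⇒consecutive k-uses) (uses⇒consecutive l-uses)))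

  at-position : ∀ {k i q v} → toℕ i ≡ q → path k i ≡ v → vertex (toℕ k) q ≡ v
  at-position refl refl = refl

  start-class : ∀ {k v} → IsStart (path k) v → Class v ≡ false
  start-class (i , i≡0 , e) = cong proj₁ (sym (at-position i≡0 e))

  endpoint-in-A : ∀ {k x} → IsEndpoint (path k) (false , x) → k ≡ x
  endpoint-in-A {k} {x} (inj₁ (i , i≡0 , e)) = toℕ-injective (begin
    toℕ k                     ≡⟨ m<n⇒m%n≡m (toℕ<n k) ⟨
    toℕ k % n                 ≡⟨ cong (_% n) (+-identityʳ (toℕ k)) ⟨
    (toℕ k + 0) % n           ≡⟨ toℕ-fromℕ< _ ⟨
    toℕ ((toℕ k + 0) mod n)   ≡⟨ cong (toℕ ∘ proj₂) (at-position i≡0 e) ⟩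
    toℕ x                     ∎)
    where open ≡-Reasoning
  endpoint-in-A (inj₂ (i , i≡end , e)) with () ← trans (sym isOdd-end) (cong proj₁ (at-position i≡end e))

  endpoint-in-B : ∀ {k y} → IsEndpoint (path k) (true , y) →
                  toℕ k + toℕ k ≡ toℕ y ⊎ toℕ k + toℕ k ≡ toℕ y + n
  endpoint-in-B (inj₁ (i , i≡0 , e)) with () ← cong proj₁ (at-position i≡0 e)
  endpoint-in-B {k} {y} (inj₂ (i , i≡end , e)) =
    subst (λ r → 2k ≡ r ⊎ 2k ≡ r + n) 2k%n≡y (m<n+n⇒m≡m%n⊎m≡m%n+n (+-mono-< (toℕ<n k) (toℕ<n k)))
    where
    open ≡-Reasoning
    2k : ℕ
    2k = toℕ k + toℕ k
    2k%n≡y : 2k % n ≡ toℕ y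
    2k%n≡y = begin
      2k % n                                       ≡⟨ [m+n]%n≡m%n 2k n ⟨
      (2k + n) % n                                 ≡⟨ cong (_% n) (label-end (toℕ k)) ⟨
      label (toℕ k) (n + n ∸ 1) % n                ≡⟨ toℕ-fromℕ< _ ⟨
      toℕ (label (toℕ k) (n + n ∸ 1) mod n)        ≡⟨ cong (toℕ ∘ proj₂) (at-position i≡end e) ⟩
      toℕ y                                        ∎

  endpoints-≤2 : ∀ v → AtMostEndpoints path v 2
  endpoints-≤2 (false , x) _ unique ends =
    m≤n⇒m≤1+n (unique-all-length≤1 (λ k≡x l≡x → trans k≡x (sym l≡x)) unique (All.map endpoint-in-A ends))
  endpoints-≤2 (true , y) _ unique ends =
    unique-all-length≤2 doubling-fiber doubling-fiber unique (All.map endpoint-in-B ends)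
    where
    doubling-fiber : ∀ {c} → AtMostOne (λ (k : Fin n) → toℕ k + toℕ k ≡ c)
    doubling-fiber k+k≡c l+l≡c = toℕ-injective (m+m≡n+n⇒m≡n (trans k+k≡c (sym l+l≡c)))

lemma2p4 : ∃[ n₀ ] ∀ (n : ℕ) → n ≥ n₀ →
    Σ (Fin n → Seq n) λ P →
      (∀ k → IsHamPath (P k)) ×
      EdgeDisjoint P ×
      (∃[ c ] ∀ k → ∀ v → IsStart (P k) v → Class v ≡ c) ×
      (∀ v → ∃[ b ] (AtMostEndpoints P v b × LeTwoSqrtLog b n))
lemma2p4 = 3 , λ where
  (suc m) n≥3 → let open RotationPaths m in
    path , path-isHamPath , paths-edgeDisjoint , (false , λ _ _ → start-class) ,
    λ v → 2 , endpoints-≤2 v , 2≤2√log n≥3
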